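{- Let $P_1$ be the poset on $\{0,1,\dots,8\}$ whose order is generated (by transitivity) by the covering relations $0<3$, $0<4$, $1<3$, $1<5$, $2<4$, $2<5$, $3<6$, $3<7$, $4<6$, $4<8$, $5<7$, $5<8$. Let $P_2$ be the poset on $\{0,1,\dots,8\}$ whose order is generated by the covering relations $0<3$, $0<4$, $0<5$, $1<3$, $1<5$, $2<3$, $2<4$, $2<5$, $3<6$, $3<7$, $4<6$, $4<8$, $5<7$, $5<8$. Let $P$ be either $P_1$ or $P_2$. If $f\colon P\to P$ is an order-preserving map without fixed points, then $f(\{3,4,5\})=\{3,4,5\}$. -}

module Defs where

open import Data.Fin using (Fin; #_)
open import Data.Product using (Σ; _×_)
open import Relation.Binary.PropositionalEquality using (_≡_; _≢_)
open import Relation.Binary.Construct.Closure.ReflexiveTransitive using (Star)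

P : Set
P = Fin 9

data Cover₁ : P → P → Set where
  c03 : Cover₁ (# 0) (# 3)
  c04 : Cover₁ (# 0) (# 4)
  c13 : Cover₁ (# 1) (# 3)
  c15 : Cover₁ (# 1) (# 5)
  c24 : Cover₁ (# 2) (# 4)
  c25 : Cover₁ (# 2) (# 5)
  c36 : Cover₁ (# 3) (# 6)
  c37 : Cover₁ (# 3) (# 7)
  c46 : Cover₁ (# 4) (# 6)
  c48 : Cover₁ (# 4) (# 8)
  c57 : Cover₁ (# 5) (# 7)
  c58 : Cover₁ (# 5) (# 8)

data Cover₂ : P → P → Set where
  c03 : Cover₂ (# 0) (# 3)
  c04 : Cover₂ (# 0) (# 4)
  c05 : Cover₂ (# 0) (# 5)
  c13 : Cover₂ (# 1) (# 3)
  c15 : Cover₂ (# 1) (# 5)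
  c23 : Cover₂ (# 2) (# 3)
  c24 : Cover₂ (# 2) (# 4)
  c25 : Cover₂ (# 2) (# 5)
  c36 : Cover₂ (# 3) (# 6)
  c37 : Cover₂ (# 3) (# 7)
  c46 : Cover₂ (# 4) (# 6)
  c48 : Cover₂ (# 4) (# 8)
  c57 : Cover₂ (# 5) (# 7)
  c58 : Cover₂ (# 5) (# 8)

Order : (P → P → Set) → P → P → Set
Order R = Star R

_≤₁_ : P → P → Set
_≤₁_ = Order Cover₁

_≤₂_ : P → P → Set
_≤₂_ = Order Cover₂

OrderPreserving : (P → P → Set) → (P → P) → Set
OrderPreserving _≤_ f = ∀ x y → x ≤ y → f x ≤ f y

FixedPointFree : (P → P) → Set
FixedPointFree f = ∀ x → f x ≢ x

data Mid : P → Set where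
  m3 : Mid (# 3)
  m4 : Mid (# 4)
  m5 : Mid (# 5)

MapsMidOntoMid : (P → P) → Set
MapsMidOntoMid f =
  (∀ x → Mid x → Mid (f x)) ×
  (∀ y → Mid y → Σ P (λ x → Mid x × (f x ≡ y)))

-- An order-preserving map P → P is determined by its nine values, so the theorem is a finite
-- check.  The values f 0, …, f 8 are chosen one at a time and a branch is abandoned as soon as
-- a chosen value is a fixed point or breaks a cover between two chosen points; a few thousand
-- branches survive, and at each of their leaves f permutes {3,4,5}.  Values are compared
-- through an up-set table ↑ that need only contain the order: reflexivity and antitonicity
-- along covers already force y ∈ ↑ x whenever x ≤ y.
module Submission where

open import Data.Bool.Base using (Bool; true; T; if_then_else_)
open import Data.Bool.ListAction using (all)
open import Data.Fin using (Fin; #_)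
open import Data.Fin.Properties as Fin using (_≟_)
open import Data.List.Base using (List; []; _∷_; allFin)
import Data.List.Membership.DecPropositional as DecMembership
open import Data.List.Membership.Propositional using (_∈_; find)
open import Data.List.Membership.Propositional.Properties using (∈-allFin)
open import Data.List.Relation.Unary.All as All using (All)
open import Data.List.Relation.Unary.All.Properties using (all⁺)
open import Data.List.Relation.Binary.Subset.Propositional using (_⊆_)
import Data.List.Relation.Binary.Subset.DecPropositional as DecSubset
open import Data.List.Relation.Unary.Any as Any using (Any; here; there)
open import Data.Maybe.Base using (Maybe; just; nothing)
import Data.Maybe.Relation.Unary.All as MaybeAll
import Data.Maybe.Relation.Unary.Any as MaybeAny
open import Data.Nat.Base using (ℕ)
open import Data.Product.Base using (Σ; _×_; _,_; ∃₂)
open import Data.Vec.Base using (lookup; []; _∷_)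
open import Data.Vec.Functional using (Vector; updateAt)
open import Data.Vec.Functional.Properties using (updateAt-updates; updateAt-minimal)
open import Function.Base using (const)
open import Level using (Level; 0ℓ)
open import Relation.Binary.Core using (Rel)
open import Relation.Binary.Construct.Closure.ReflexiveTransitive using (Star; ε; _◅_)
open import Relation.Binary.PropositionalEquality using (_≡_; refl; _≢_; sym; subst)
open import Relation.Nullary using (Dec; yes; no; ¬?; contradiction)
open import Relation.Nullary.Decidable using (⌊_⌋; _×-dec_; _→-dec_; True; toWitness)
open import Relation.Unary using (Pred; Decidable)

open import Defs

private variable
  ℓ p : Level
  n : ℕ
  B : Set

PartialMap : ℕ → Set → Set
PartialMap n B = Vector (Maybe B) n

∅ : PartialMap n B
∅ _ = nothing

infixl 6 _[_≔_]
infix 4 _⊑_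

_[_≔_] : PartialMap n B → Fin n → B → PartialMap n B
g [ x ≔ b ] = updateAt g x (const (just b))

_⊑_ : PartialMap n B → (Fin n → B) → Set
g ⊑ f = ∀ x → MaybeAll.All (_≡ f x) (g x)

∅⊑ : (f : Fin n → B) → ∅ ⊑ f
∅⊑ f _ = MaybeAll.nothing

⊑-extend : ∀ {g : PartialMap n B} {f} x → g ⊑ f → g [ x ≔ f x ] ⊑ f
⊑-extend {g = g} x g⊑f y with y ≟ x
... | yes refl = subst (MaybeAll.All _) (sym (updateAt-updates x g)) (MaybeAll.just refl)
... | no y≢x   = subst (MaybeAll.All _) (sym (updateAt-minimal y x g y≢x)) (g⊑f y)

⊑-any : ∀ {g : PartialMap n B} {f} {Q : Pred B p} x → g ⊑ f → MaybeAny.Any Q (g x) → Q (f x)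
⊑-any {Q = Q} x g⊑f = agree (g⊑f x)
  where
  agree : ∀ {m a} → MaybeAll.All (_≡ a) m → MaybeAny.Any Q m → Q a
  agree (MaybeAll.just refl) (MaybeAny.just qa) = qa

module Search (values : List B) (values-complete : ∀ b → b ∈ values)
  {Admissible : PartialMap n B → Fin n → B → Set} (admissible? : ∀ g x b → Dec (Admissible g x b))
  {Goal : Pred (PartialMap n B) 0ℓ} (goal? : Decidable Goal) where

  search : List (Fin n) → PartialMap n B → Bool
  search []       g = ⌊ goal? g ⌋
  search (x ∷ xs) g = all branch values
    where
    branch : B → Bool
    branch b = if ⌊ admissible? g x b ⌋ then search xs (g [ x ≔ b ]) else true

  search-sound : ∀ {f} {Q : Set} →
                 (∀ {g} x → g ⊑ f → Admissible g x (f x)) → (∀ {g} → g ⊑ f → Goal g → Q) →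
                 ∀ xs {g} → g ⊑ f → T (search xs g) → Q
  search-sound admissible goal [] {g} g⊑f s = goal g⊑f (toWitness {a? = goal? g} s)
  search-sound {f} admissible goal (x ∷ xs) {g} g⊑f s
    with admissible? g x (f x) | All.lookup (all⁺ _ _ s) (values-complete (f x))
  ... | yes _          | s′ = search-sound admissible goal xs (⊑-extend x g⊑f) s′
  ... | no ¬admissible | _  = contradiction (admissible x g⊑f) ¬admissible

module _ {R : Rel (Fin n) ℓ} (↑ : Fin n → List (Fin n))
  (↑-refl : ∀ x → x ∈ ↑ x) (↑-antitone : ∀ {x y} → R x y → ↑ y ⊆ ↑ x) where

  star⇒∈↑ : ∀ {x y} → Star R x y → y ∈ ↑ x
  star⇒∈↑ {x} ε    = ↑-refl x
  star⇒∈↑ (r ◅ rs) = ↑-antitone r (star⇒∈↑ rs)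

-- Omitting a cover from covers only weakens the pruning, so covers need not be complete.
module Admissibility {n} {R : Rel (Fin n) 0ℓ} (↑ : Fin n → List (Fin n)) (covers : List (∃₂ R)) where

  open DecMembership (_≟_ {n = n}) using (_∈?_)

  Admissible : PartialMap n (Fin n) → Fin n → Fin n → Set
  Admissible g x b = b ≢ x × All (λ (y , z , _) →
    (y ≡ x → MaybeAll.All (_∈ ↑ b) (g z)) × (z ≡ x → MaybeAll.All (λ c → b ∈ ↑ c) (g y))) covers

  admissible? : ∀ g x b → Dec (Admissible g x b)
  admissible? g x b = ¬? (b ≟ x) ×-dec All.all? (λ (y , z , _) →
    (y ≟ x →-dec MaybeAll.dec (_∈? ↑ b) (g z)) ×-dec (z ≟ x →-dec MaybeAll.dec (λ c → b ∈? ↑ c) (g y))) covers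

  module _ (↑-refl : ∀ x → x ∈ ↑ x) (↑-antitone : ∀ {x y} → R x y → ↑ y ⊆ ↑ x)
    {f : Fin n → Fin n} (monotone : ∀ x y → Star R x y → Star R (f x) (f y)) (fpf : ∀ x → f x ≢ x) where

    admissible : ∀ {g} x → g ⊑ f → Admissible g x (f x)
    admissible {g} x g⊑f = fpf x , All.universal coverRespected covers
      where
      f-monotone : ∀ {y z} → R y z → f z ∈ ↑ (f y)
      f-monotone {y} {z} r = star⇒∈↑ ↑ ↑-refl ↑-antitone (monotone y z (r ◅ ε))
      coverRespected : ((y , z , _) : ∃₂ R) →
        (y ≡ x → MaybeAll.All (_∈ ↑ (f x)) (g z)) × (z ≡ x → MaybeAll.All (λ c → f x ∈ ↑ c) (g y))
      coverRespected (y , z , r) =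
        (λ { refl → MaybeAll.map (λ { refl → f-monotone r }) (g⊑f z) }) ,
        (λ { refl → MaybeAll.map (λ { refl → f-monotone r }) (g⊑f y) })

open DecMembership (_≟_ {n = 9}) using (_∈?_)
open DecSubset (_≟_ {n = 9}) using (_⊆?_)

mids : List P
mids = # 3 ∷ # 4 ∷ # 5 ∷ []

Mid⇒∈mids : ∀ {x} → Mid x → x ∈ mids
Mid⇒∈mids m3 = here refl
Mid⇒∈mids m4 = there (here refl)
Mid⇒∈mids m5 = there (there (here refl))

∈mids⇒Mid : ∀ {x} → x ∈ mids → Mid x
∈mids⇒Mid (here refl)                 = m3
∈mids⇒Mid (there (here refl))         = m4
∈mids⇒Mid (there (there (here refl))) = m5

MapsMidOntoMidᵖ : Pred (PartialMap 9 P) 0ℓ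
MapsMidOntoMidᵖ g =
  All (λ x → MaybeAny.Any (_∈ mids) (g x)) mids ×
  All (λ y → Any (λ x → MaybeAny.Any (_≡ y) (g x)) mids) mids

mapsMidOntoMidᵖ? : Decidable MapsMidOntoMidᵖ
mapsMidOntoMidᵖ? g =
  All.all? (λ x → MaybeAny.dec (_∈? mids) (g x)) mids ×-dec
  All.all? (λ y → Any.any? (λ x → MaybeAny.dec (_≟ y) (g x)) mids) mids

⊑-mapsMidOntoMid : ∀ {g f} → g ⊑ f → MapsMidOntoMidᵖ g → MapsMidOntoMid f
⊑-mapsMidOntoMid {g} {f} g⊑f (into , onto) = into′ , onto′
  where
  into′ : ∀ x → Mid x → Mid (f x)
  into′ x mx = ∈mids⇒Mid (⊑-any x g⊑f (All.lookup into (Mid⇒∈mids mx)))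
  onto′ : ∀ y → Mid y → Σ P (λ x → Mid x × f x ≡ y)
  onto′ y my with find (All.lookup onto (Mid⇒∈mids my))
  ... | x , x∈mids , gx≡y = x , ∈mids⇒Mid x∈mids , ⊑-any x g⊑f gx≡y

module FixedPointFreeMaps {R : Rel P 0ℓ} (↑ : P → List P)
  (↑-refl : ∀ x → x ∈ ↑ x) (↑-antitone : ∀ {x y} → R x y → ↑ y ⊆ ↑ x) (covers : List (∃₂ R)) where

  open Admissibility ↑ covers
  open Search (allFin 9) ∈-allFin admissible? mapsMidOntoMidᵖ?

  mapsMidOntoMid : T (search (allFin 9) ∅) →
    (f : P → P) → OrderPreserving (Star R) f → FixedPointFree f → MapsMidOntoMid f
  mapsMidOntoMid s f monotone fpf =
    search-sound (admissible ↑-refl ↑-antitone monotone fpf) ⊑-mapsMidOntoMid (allFin 9) {∅} (∅⊑ f) s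

↑₁ : P → List P
↑₁ = lookup
  ( (# 0 ∷ # 3 ∷ # 4 ∷ # 6 ∷ # 7 ∷ # 8 ∷ [])
  ∷ (# 1 ∷ # 3 ∷ # 5 ∷ # 6 ∷ # 7 ∷ # 8 ∷ [])
  ∷ (# 2 ∷ # 4 ∷ # 5 ∷ # 6 ∷ # 7 ∷ # 8 ∷ [])
  ∷ (# 3 ∷ # 6 ∷ # 7 ∷ [])
  ∷ (# 4 ∷ # 6 ∷ # 8 ∷ [])
  ∷ (# 5 ∷ # 7 ∷ # 8 ∷ [])
  ∷ (# 6 ∷ []) ∷ (# 7 ∷ []) ∷ (# 8 ∷ []) ∷ [])

↑₁-refl : ∀ x → x ∈ ↑₁ x
↑₁-refl = toWitness {a? = Fin.all? (λ x → x ∈? ↑₁ x)} _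

↑₁-antitone : ∀ {x y} → Cover₁ x y → ↑₁ y ⊆ ↑₁ x
↑₁-antitone c = toWitness (decided c)
  where
  decided : ∀ {x y} → Cover₁ x y → True (↑₁ y ⊆? ↑₁ x)
  decided c03 = _
  decided c04 = _
  decided c13 = _
  decided c15 = _
  decided c24 = _
  decided c25 = _
  decided c36 = _
  decided c37 = _
  decided c46 = _
  decided c48 = _
  decided c57 = _
  decided c58 = _

covers₁ : List (∃₂ Cover₁)
covers₁ =
  (_ , _ , c03) ∷ (_ , _ , c04) ∷ (_ , _ , c13) ∷ (_ , _ , c15) ∷ (_ , _ , c24) ∷ (_ , _ , c25) ∷
  (_ , _ , c36) ∷ (_ , _ , c37) ∷ (_ , _ , c46) ∷ (_ , _ , c48) ∷ (_ , _ , c57) ∷ (_ , _ , c58) ∷ []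

↑₂ : P → List P
↑₂ = lookup
  ( (# 0 ∷ # 3 ∷ # 4 ∷ # 5 ∷ # 6 ∷ # 7 ∷ # 8 ∷ [])
  ∷ (# 1 ∷ # 3 ∷ # 5 ∷ # 6 ∷ # 7 ∷ # 8 ∷ [])
  ∷ (# 2 ∷ # 3 ∷ # 4 ∷ # 5 ∷ # 6 ∷ # 7 ∷ # 8 ∷ [])
  ∷ (# 3 ∷ # 6 ∷ # 7 ∷ [])
  ∷ (# 4 ∷ # 6 ∷ # 8 ∷ [])
  ∷ (# 5 ∷ # 7 ∷ # 8 ∷ [])
  ∷ (# 6 ∷ []) ∷ (# 7 ∷ []) ∷ (# 8 ∷ []) ∷ [])

↑₂-refl : ∀ x → x ∈ ↑₂ x
↑₂-refl = toWitness {a? = Fin.all? (λ x → x ∈? ↑₂ x)} _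

↑₂-antitone : ∀ {x y} → Cover₂ x y → ↑₂ y ⊆ ↑₂ x
↑₂-antitone c = toWitness (decided c)
  where
  decided : ∀ {x y} → Cover₂ x y → True (↑₂ y ⊆? ↑₂ x)
  decided c03 = _
  decided c04 = _
  decided c05 = _
  decided c13 = _
  decided c15 = _
  decided c23 = _
  decided c24 = _
  decided c25 = _
  decided c36 = _
  decided c37 = _
  decided c46 = _
  decided c48 = _
  decided c57 = _
  decided c58 = _

covers₂ : List (∃₂ Cover₂)
covers₂ =
  (_ , _ , c03) ∷ (_ , _ , c04) ∷ (_ , _ , c05) ∷ (_ , _ , c13) ∷ (_ , _ , c15) ∷ (_ , _ , c23) ∷
  (_ , _ , c24) ∷ (_ , _ , c25) ∷ (_ , _ , c36) ∷ (_ , _ , c37) ∷ (_ , _ , c46) ∷ (_ , _ , c48) ∷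
  (_ , _ , c57) ∷ (_ , _ , c58) ∷ []

mainTheorem5 :
    ((f : P → P) → OrderPreserving _≤₁_ f → FixedPointFree f → MapsMidOntoMid f) ×
    ((f : P → P) → OrderPreserving _≤₂_ f → FixedPointFree f → MapsMidOntoMid f)
mainTheorem5 =
  -- Each `_ : T (search (allFin 9) ∅)` is discharged by running the search in the type checker.
  FixedPointFreeMaps.mapsMidOntoMid ↑₁ ↑₁-refl ↑₁-antitone covers₁ _ ,
  FixedPointFreeMaps.mapsMidOntoMid ↑₂ ↑₂-refl ↑₂-antitone covers₂ _
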